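{- Let $m\in\mathbb{N}$ and let $\mathbf{0},\mathbf{1}$ be two distinct symbols. Let $W_0\subseteq\{\mathbf{0},\mathbf{1}\}^*$ contain the word $\mathbf{0}\mathbf{1}\mathbf{1}^m$, and for $i\ge1$ let $W_i=W_{i-1}\cup\{\bar w^{\lambda_1},\bar w^{\lambda_2},\bar w^{\lambda_3}:\bar w\in W_{i-1}\}$. Setting $W=\bigcup_{i\ge0}W_i$, we have $\mathbf{0}\mathbf{1}\{\mathbf{0},\mathbf{1}\}^m\subseteq W$.
   Context: The functions $\lambda_1,\lambda_2,\lambda_3$ on $[1,m+2]$ are: $\lambda_1(1)=1$, $\lambda_1(2)=2$, $\lambda_1(j)=j-1$ for $3\le j\le m+2$; $\lambda_2(1)=1$, $\lambda_2(2)=2$, $\lambda_2(j)=j-2$ for $3\le j\le m+2$; $\lambda_3(1)=1$, $\lambda_3(2)=2$, $\lambda_3(3)=3$, $\lambda_3(j)=j-1$ for $4\le j\le m+2$. For a word $\bar w=w_1\cdots w_{m+2}$ and $\lambda\colon[1,m+2]\to[1,m+2]$, $\bar w^\lambda=w_{\lambda(1)}\cdots w_{\lambda(m+2)}$ (the operations are applied to words of length $m+2$). -}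

module Defs where

open import Data.Nat using (ℕ; zero; suc)
open import Data.Bool using (Bool; false; true)
open import Data.Fin using (Fin; zero; suc; inject₁)
open import Data.Vec using (Vec; lookup; tabulate; toList)
open import Data.List using (List)
open import Data.Product using (Σ; _×_; ∃)
open import Data.Sum using (_⊎_)
open import Relation.Binary.PropositionalEquality using (_≡_)

-- Symbols: 𝟎 is false, 𝟏 is true.  Words in {𝟎,𝟏}* are List Bool.
-- Positions [1, m+2] are represented 0-indexed as Fin (2 + m):
-- paper position j corresponds to Fin value j - 1.

-- λ₁(1)=1, λ₁(2)=2, λ₁(j)=j-1 for 3 ≤ j ≤ m+2
λ₁ : {m : ℕ} → Fin (suc (suc m)) → Fin (suc (suc m))
λ₁ zero = zero
λ₁ (suc zero) = suc zero
λ₁ (suc (suc j)) = inject₁ (suc j)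

-- λ₂(1)=1, λ₂(2)=2, λ₂(j)=j-2 for 3 ≤ j ≤ m+2
λ₂ : {m : ℕ} → Fin (suc (suc m)) → Fin (suc (suc m))
λ₂ zero = zero
λ₂ (suc zero) = suc zero
λ₂ (suc (suc j)) = inject₁ (inject₁ j)

-- λ₃(1)=1, λ₃(2)=2, λ₃(3)=3, λ₃(j)=j-1 for 4 ≤ j ≤ m+2
λ₃ : {m : ℕ} → Fin (suc (suc m)) → Fin (suc (suc m))
λ₃ zero = zero
λ₃ (suc zero) = suc zero
λ₃ (suc (suc zero)) = suc (suc zero)
λ₃ (suc (suc (suc k))) = suc (suc (inject₁ k))

lam : {m : ℕ} → Fin 3 → Fin (suc (suc m)) → Fin (suc (suc m))
lam zero = λ₁
lam (suc zero) = λ₂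
lam (suc (suc zero)) = λ₃

applyλ : {m : ℕ} → (Fin (suc (suc m)) → Fin (suc (suc m)))
       → Vec Bool (suc (suc m)) → Vec Bool (suc (suc m))
applyλ λf w = tabulate (λ j → lookup w (λf j))

Wi : (m : ℕ) → (List Bool → Set) → ℕ → List Bool → Set
Wi m W₀ zero w = W₀ w
Wi m W₀ (suc i) w =
  Wi m W₀ i w ⊎
  Σ (Vec Bool (suc (suc m))) (λ v → Wi m W₀ i (toList v) ×
     Σ (Fin 3) (λ k → w ≡ toList (applyλ (lam k) v)))

Wall : (m : ℕ) → (List Bool → Set) → List Bool → Set
Wall m W₀ w = ∃ (λ i → Wi m W₀ i w)

-- On a word 𝟎𝟏t the three operations fix the prefix 𝟎𝟏 and act on the tail t
-- (with the last letters falling off the end): λ₁ pushes a 𝟏 in front of t,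
-- λ₂ pushes 𝟎𝟏, and λ₃ doubles the first letter of t.  Hence, starting from
-- t = 𝟏ᵐ, any tail u can be produced from right to left: a letter 𝟏 is pushed
-- by λ₁, a letter 𝟎 followed by 𝟏 (or by nothing) by λ₂, and a letter 𝟎
-- followed by 𝟎 by doubling that 𝟎 with λ₃.
module Submission where

open import Defs
open import Data.Nat using (ℕ; suc)
open import Data.Bool using (Bool; false; true)
open import Data.List using (List; _∷_; []; replicate)
open import Data.Vec using (Vec; toList; _∷_; []; lookup; tabulate)
import Data.Vec as Vec
open import Data.Vec.Properties using (tabulate-cong; tabulate∘lookup; toList-replicate)
open import Data.Fin using (Fin; zero; suc; inject₁)
open import Data.Product using (Σ; _×_; _,_)
open import Data.Sum using (inj₂)
open import Data.Unit using (⊤; tt)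
open import Relation.Binary.PropositionalEquality

shiftIn : {n : ℕ} → Bool → Vec Bool n → Vec Bool n
shiftIn b []       = []
shiftIn b (x ∷ xs) = b ∷ shiftIn x xs

doubleHead : {n : ℕ} → Vec Bool n → Vec Bool n
doubleHead []       = []
doubleHead (x ∷ xs) = x ∷ shiftIn x xs

lookup-shiftIn : {n : ℕ} (b : Bool) (t : Vec Bool n) (j : Fin n) →
                 lookup (shiftIn b t) j ≡ lookup (b ∷ t) (inject₁ j)
lookup-shiftIn b (x ∷ xs) zero    = refl
lookup-shiftIn b (x ∷ xs) (suc j) = lookup-shiftIn x xs j

lookup-shiftIn² : {n : ℕ} (a b : Bool) (t : Vec Bool n) (j : Fin n) →
                  lookup (shiftIn a (shiftIn b t)) j ≡ lookup (a ∷ b ∷ t) (inject₁ (inject₁ j))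
lookup-shiftIn² a b (x ∷ xs) zero    = refl
lookup-shiftIn² a b (x ∷ xs) (suc j) = lookup-shiftIn² b x xs j

tabulate-lookup-shiftIn : {n : ℕ} (b : Bool) (t : Vec Bool n) →
                          tabulate (λ j → lookup (b ∷ t) (inject₁ j)) ≡ shiftIn b t
tabulate-lookup-shiftIn b t =
  trans (tabulate-cong (λ j → sym (lookup-shiftIn b t j))) (tabulate∘lookup _)

applyλ₁-01 : {m : ℕ} (t : Vec Bool m) →
             applyλ λ₁ (false ∷ true ∷ t) ≡ false ∷ true ∷ shiftIn true t
applyλ₁-01 t = cong (λ z → false ∷ true ∷ z) (tabulate-lookup-shiftIn true t)

applyλ₂-01 : {m : ℕ} (t : Vec Bool m) →
             applyλ λ₂ (false ∷ true ∷ t) ≡ false ∷ true ∷ shiftIn false (shiftIn true t)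
applyλ₂-01 t = cong (λ z → false ∷ true ∷ z)
  (trans (tabulate-cong (λ j → sym (lookup-shiftIn² false true t j))) (tabulate∘lookup _))

applyλ₃-01 : {m : ℕ} (t : Vec Bool m) →
             applyλ λ₃ (false ∷ true ∷ t) ≡ false ∷ true ∷ doubleHead t
applyλ₃-01 []       = refl
applyλ₃-01 (x ∷ xs) = cong (λ z → false ∷ true ∷ x ∷ z) (tabulate-lookup-shiftIn x xs)

-- s and t agree on their common length; the truncation makes shiftIn and
-- doubleHead compatible with it without any length bookkeeping.
Agree : {n : ℕ} → List Bool → Vec Bool n → Set
Agree []       _        = ⊤
Agree (x ∷ xs) []       = ⊤
Agree (x ∷ xs) (y ∷ ys) = x ≡ y × Agree xs ys

agree-shiftIn : {n : ℕ} (b : Bool) {s : List Bool} {t : Vec Bool n} →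
                Agree s t → Agree (b ∷ s) (shiftIn b t)
agree-shiftIn b {t = []}                  _          = tt
agree-shiftIn b {s = []}     {t = y ∷ ys} _          = refl , tt
agree-shiftIn b {s = x ∷ xs} {t = y ∷ ys} (refl , a) = refl , agree-shiftIn x a

agree-doubleHead : {n : ℕ} {x : Bool} {s : List Bool} {t : Vec Bool n} →
                   Agree (x ∷ s) t → Agree (x ∷ x ∷ s) (doubleHead t)
agree-doubleHead {t = []}     _          = tt
agree-doubleHead {t = y ∷ ys} (refl , a) = refl , agree-shiftIn y a

agree-toList⇒≡ : {n : ℕ} (u t : Vec Bool n) → Agree (toList u) t → t ≡ u
agree-toList⇒≡ []       []       _          = refl
agree-toList⇒≡ (x ∷ xs) (y ∷ ys) (refl , a) = cong (x ∷_) (agree-toList⇒≡ xs ys a)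

Wall-applyλ : (m : ℕ) (W₀ : List Bool → Set) (k : Fin 3) (v : Vec Bool (suc (suc m))) →
              Wall m W₀ (toList v) → Wall m W₀ (toList (applyλ (lam k) v))
Wall-applyλ m W₀ k v (i , v∈Wᵢ) = suc i , inj₂ (v , v∈Wᵢ , k , refl)

module _ (m : ℕ) (W₀ : List Bool → Set) where

  Reachable : Vec Bool m → Set
  Reachable t = Wall m W₀ (false ∷ true ∷ toList t)

  reachable-step : (k : Fin 3) {t t′ : Vec Bool m} →
                   applyλ (lam k) (false ∷ true ∷ t) ≡ false ∷ true ∷ t′ →
                   Reachable t → Reachable t′
  reachable-step k eq r = subst (Wall m W₀) (cong toList eq) (Wall-applyλ m W₀ k _ r)

  Realised : List Bool → Set
  Realised s = Σ (Vec Bool m) (λ t → Reachable t × Agree s t)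

  extend : {s s′ : List Bool} (f : Vec Bool m → Vec Bool m) →
           (∀ {t} → Reachable t → Reachable (f t)) →
           (∀ {t} → Agree s t → Agree s′ (f t)) →
           Realised s → Realised s′
  extend f reach agree (t , r , a) = f t , reach r , agree a

  realised : W₀ (false ∷ true ∷ replicate m true) → (s : List Bool) → Realised s
  realised w₀ [] = Vec.replicate m true
                 , (0 , subst (λ z → W₀ (false ∷ true ∷ z)) (sym (toList-replicate m true)) w₀)
                 , tt
  realised w₀ (true ∷ s) =
    extend (shiftIn true) (reachable-step zero (applyλ₁-01 _))
           (agree-shiftIn true) (realised w₀ s)
  realised w₀ (false ∷ []) =
    extend {s = []} (λ t → shiftIn false (shiftIn true t)) (reachable-step (suc zero) (applyλ₂-01 _))
           (λ _ → agree-shiftIn false tt) (realised w₀ [])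
  realised w₀ (false ∷ true ∷ s) =
    extend (λ t → shiftIn false (shiftIn true t)) (reachable-step (suc zero) (applyλ₂-01 _))
           (λ a → agree-shiftIn false (agree-shiftIn true a)) (realised w₀ s)
  realised w₀ (false ∷ false ∷ s) =
    extend doubleHead (reachable-step (suc (suc zero)) (applyλ₃-01 _))
           agree-doubleHead (realised w₀ (false ∷ s))

lemma17 : (m : ℕ) (W₀ : List Bool → Set) →
    W₀ (false ∷ true ∷ replicate m true) →
    (u : Vec Bool m) → Wall m W₀ (false ∷ true ∷ toList u)
lemma17 m W₀ w₀ u with realised m W₀ w₀ (toList u)
... | t , r , a = subst (Reachable m W₀) (agree-toList⇒≡ u t a) r
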